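{- Let $R_2 \subsetneq S_2 \subseteq \{0,1,2\}^4$ be given by $S_2 = C_6 \times C_6$ and $R_2 = (C_6^{*} \times C_6) \cup (C_6 \times C_6^{*})$. There is a constant $C>0$ such that for infinitely many $m$, there is a $4$-partite non-redundant instance $(V_1,V_2,V_3,V_4,E)$ of $\operatorname{CSP}(R_2 \mid S_2)$ with $|E| = m$ such that $|\pi_I E| \le C m^{5/6}$ for every $I \subsetneq [4]$ (i.e. it is $\Omega(m^{1/6})$-shrinking).
   Context: $C_6 = \{(0,0),(0,1),(1,0),(1,2),(2,1),(2,2)\}$ and $C_6^{*} = C_6\setminus\{(0,0)\}$; $R_2\mid S_2$ is the box product $(C_6^*\mid C_6)\boxtimes(C_6^*\mid C_6)$ (tuples concatenated). An $r$-partite instance is $(V_1,\dots,V_r,E)$ with $E\subseteq V_1\times\dots\times V_r$. For $P\subsetneq Q\subseteq D^r$ it is non-redundant for $\operatorname{CSP}(P\mid Q)$ if for every $e\in E$ there is $\psi_e:\bigsqcup V_i\to D$ with $\psi_e(e')\in P$ for all $e'\neq e$ and $\psi_e(e)\in Q\setminus P$. For $I\subseteq[r]$, $\pi_I E = \{(e_i : i \in I) : e\in E\}$. A hypergraph is $\lambda$-shrinking if $|\pi_I E|\le |E|/\lambda$ for all $I\subsetneq[r]$. -}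

module Defs where

open import Data.Nat using (ℕ; zero; suc; _≤_; _^_; _*_)
open import Data.Fin using (Fin; zero; suc)
import Data.Fin.Properties as FinP
open import Data.Bool using (Bool; true; false; if_then_else_)
open import Data.Maybe using (Maybe; just; nothing)
import Data.Maybe.Properties as MaybeP
open import Data.Product using (_×_; _,_; Σ; ∃)
import Data.Product.Properties as ProdP
open import Data.Sum using (_⊎_)
open import Data.List using (List; length; map; deduplicate)
open import Data.List.Membership.Propositional using (_∈_)
open import Data.List.Relation.Unary.Unique.Propositional using (Unique)
open import Relation.Binary.PropositionalEquality using (_≡_; _≢_)
open import Relation.Binary.Definitions using (DecidableEquality)
open import Relation.Nullary using (¬_)

D : Set
D = Fin 3

pattern d0 = zero
pattern d1 = suc zero
pattern d2 = suc (suc zero)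

data C6 : D → D → Set where
  c00 : C6 d0 d0
  c01 : C6 d0 d1
  c10 : C6 d1 d0
  c12 : C6 d1 d2
  c21 : C6 d2 d1
  c22 : C6 d2 d2

C6* : D → D → Set
C6* a b = C6 a b × ¬ (a ≡ d0 × b ≡ d0)

D⁴ : Set
D⁴ = D × D × D × D

S2 : D⁴ → Set
S2 (a , b , c , d) = C6 a b × C6 c d

R2 : D⁴ → Set
R2 (a , b , c , d) = (C6* a b × C6 c d) ⊎ (C6 a b × C6* c d)

-- A 4-partite instance: vertex sets V_i = Fin (n_i), and E a duplicate-free
-- list of hyperedges in V₁ × V₂ × V₃ × V₄.
Edge : (n₁ n₂ n₃ n₄ : ℕ) → Set
Edge n₁ n₂ n₃ n₄ = Fin n₁ × Fin n₂ × Fin n₃ × Fin n₄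

-- An assignment ψ : V₁ ⊔ V₂ ⊔ V₃ ⊔ V₄ → D, given componentwise.
Assignment : (n₁ n₂ n₃ n₄ : ℕ) → Set
Assignment n₁ n₂ n₃ n₄ =
  (Fin n₁ → D) × (Fin n₂ → D) × (Fin n₃ → D) × (Fin n₄ → D)

apply : ∀ {n₁ n₂ n₃ n₄} → Assignment n₁ n₂ n₃ n₄ → Edge n₁ n₂ n₃ n₄ → D⁴
apply (f₁ , f₂ , f₃ , f₄) (x₁ , x₂ , x₃ , x₄) = (f₁ x₁ , f₂ x₂ , f₃ x₃ , f₄ x₄)

NonRedundant : ∀ {n₁ n₂ n₃ n₄} → List (Edge n₁ n₂ n₃ n₄) → Set
NonRedundant {n₁} {n₂} {n₃} {n₄} E =
  ∀ e → e ∈ E →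
    Σ (Assignment n₁ n₂ n₃ n₄) λ ψ →
      (∀ e′ → e′ ∈ E → e′ ≢ e → R2 (apply ψ e′))
      × S2 (apply ψ e) × ¬ R2 (apply ψ e)

-- Subsets I ⊆ [4] as characteristic vectors; I ⊊ [4] means some coordinate is false.
Subset4 : Set
Subset4 = Bool × Bool × Bool × Bool

Proper : Subset4 → Set
Proper I = ¬ (I ≡ (true , true , true , true))

-- Projection of an edge onto the coordinates in I (other coordinates erased).
ProjEdge : (n₁ n₂ n₃ n₄ : ℕ) → Set
ProjEdge n₁ n₂ n₃ n₄ = Maybe (Fin n₁) × Maybe (Fin n₂) × Maybe (Fin n₃) × Maybe (Fin n₄)

keep : ∀ {A : Set} → Bool → A → Maybe A
keep b x = if b then just x else nothing

proj : ∀ {n₁ n₂ n₃ n₄} → Subset4 → Edge n₁ n₂ n₃ n₄ → ProjEdge n₁ n₂ n₃ n₄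
proj (b₁ , b₂ , b₃ , b₄) (x₁ , x₂ , x₃ , x₄) =
  (keep b₁ x₁ , keep b₂ x₂ , keep b₃ x₃ , keep b₄ x₄)

_≟P_ : ∀ {n₁ n₂ n₃ n₄} → DecidableEquality (ProjEdge n₁ n₂ n₃ n₄)
_≟P_ = ProdP.≡-dec (MaybeP.≡-dec FinP._≟_)
         (ProdP.≡-dec (MaybeP.≡-dec FinP._≟_)
           (ProdP.≡-dec (MaybeP.≡-dec FinP._≟_) (MaybeP.≡-dec FinP._≟_)))

projCard : ∀ {n₁ n₂ n₃ n₄} → Subset4 → List (Edge n₁ n₂ n₃ n₄) → ℕ
projCard I E = length (deduplicate _≟P_ (map (proj I) E))

{-# OPTIONS --safe #-}
-- Let G be the point-line incidence graph of the affine plane over 𝔽ₚ: p² points, p² lines,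
-- p³ incidences, and no 4-cycle. In a C₄-free bipartite graph every edge (P₀ , L₀) is
-- non-redundant for CSP(C₆* | C₆): colour a point 0 if it is P₀, 1 if it lies on L₀ and 2
-- otherwise, and a line 0 if it is L₀, 1 if it passes through P₀ and 2 otherwise; the only
-- non-edge of C₆ in {1,2}², namely (1,1), would close a 4-cycle through P₀ and L₀. Witnesses
-- for two binary instances concatenate to witnesses for their box product, so E = G ⊠ G is
-- non-redundant for CSP(R₂ | S₂), and |E| = p⁶. A proper projection of E forgets a coordinate,
-- so it is covered by G × (one vertex class) and has at most p³ · p² = p⁵ elements. As primes
-- are unbounded, C = 1 works.
module Submission where

open import Defs
open import Data.Bool.Base using (true; false)
open import Data.Empty using (⊥-elim)
open import Data.Fin.Base using (Fin; zero; suc; toℕ; fromℕ<; combine; remQuot)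
open import Data.Fin.Properties
  using ( toℕ-fromℕ<; toℕ-injective; toℕ<n; remQuot-combine; combine-remQuot; combine-injectiveˡ
        ; injective⇒≤)
  renaming (_≟_ to _≟ᶠ_)
open import Data.List.Base as List
  using (List; length; map; allFin; cartesianProductWith; lookup)
open import Data.List.Properties using (length-++; length-map; length-tabulate)
open import Data.List.Membership.Propositional using (_∈_)
open import Data.List.Membership.Propositional.Properties
  using ( ∈-cartesianProductWith⁺; ∈-cartesianProductWith⁻; ∈-allFin; ∈-map⁻; ∈-lookup
        ; ∈-deduplicate⁻)
open import Data.List.Membership.Setoid.Properties using (index-injective)
open import Data.List.Relation.Binary.Subset.Propositional using (_⊆_)
import Data.List.Relation.Unary.All as All
open import Data.List.Relation.Unary.AllPairs using (_∷_)
open import Data.List.Relation.Unary.Unique.Propositional using (Unique)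
import Data.List.Relation.Unary.Unique.Propositional.Properties as Unique
import Data.List.Relation.Unary.Unique.DecPropositional.Properties as UniqueDec
open import Data.Maybe.Base using (just; nothing)
open import Data.Nat.Base using (ℕ; zero; suc; z≤n; s≤s; z<s; NonZero; _≤_; _<_; _⊔_; _^_; _!)
open import Data.Nat.Properties
  using ( suc-injective; +-comm; *-identityˡ; ≤-trans; <⇒≤; <⇒≢; ≰⇒>; 1≤n!; *-monoˡ-≤
        ; ^-monoˡ-≤; ^-monoʳ-≤; ^-identityʳ; ^-*-assoc; m≤m⊔n; m≤n⊔m; ⊔-idem; ⊔-lub
        ; module ≤-Reasoning)
open import Data.Nat.Primality using (Prime; euclidsLemma; prime⇒nonZero; ¬prime[0]; ¬prime[1])
open import Data.Nat.Primality.Factorisation using (factorise)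
open import Data.Product using (Σ; ∃; ∃₂; _×_; _,_; proj₁; proj₂; uncurry)
open import Data.Product.Properties using (,-injective) renaming (≡-dec to ×-≡-dec)
open import Data.Sum as Sum using (_⊎_; inj₁; inj₂)
open import Function using (_∘_; Injective)
open import Relation.Binary.PropositionalEquality
open import Relation.Nullary using (¬_; Dec; yes; no; contradiction)

private variable
  n₁ n₂ n₃ n₄ : ℕ

C4Free : ∀ {A B : Set} → (A → B → Set) → Set
C4Free _~_ = ∀ {P Q L M} → P ~ L → Q ~ L → P ~ M → Q ~ M → P ≡ Q ⊎ L ≡ M

C4Free-preimage : ∀ {A B A′ B′ : Set} {_~_ : A → B → Set} {f : A′ → A} {g : B′ → B} →
                  Injective _≡_ _≡_ f → Injective _≡_ _≡_ g →
                  C4Free _~_ → C4Free (λ P L → f P ~ g L)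
C4Free-preimage f-injective g-injective c4 PL QL PM QM =
  Sum.map f-injective g-injective (c4 PL QL PM QM)

_≟ᵖ_ : (e e′ : Fin n₁ × Fin n₂) → Dec (e ≡ e′)
_≟ᵖ_ = ×-≡-dec _≟ᶠ_ _≟ᶠ_

record C6Witness (G : List (Fin n₁ × Fin n₂)) (a : Fin n₁) (b : Fin n₂) : Set where
  field
    ψ₁ : Fin n₁ → D
    ψ₂ : Fin n₂ → D
    zero-at : ψ₁ a ≡ d0 × ψ₂ b ≡ d0
    C6*-elsewhere : ∀ {a′ b′} → (a′ , b′) ∈ G → (a′ , b′) ≢ (a , b) → C6* (ψ₁ a′) (ψ₂ b′)

  C6-everywhere : ∀ {a′ b′} → (a′ , b′) ∈ G → C6 (ψ₁ a′) (ψ₂ b′)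
  C6-everywhere {a′} {b′} e∈G with (a′ , b′) ≟ᵖ (a , b)
  ... | yes refl = subst₂ C6 (sym (proj₁ zero-at)) (sym (proj₂ zero-at)) c00
  ... | no e≢ = proj₁ (C6*-elsewhere e∈G e≢)

NonRedundantC6 : List (Fin n₁ × Fin n₂) → Set
NonRedundantC6 G = ∀ {a b} → (a , b) ∈ G → C6Witness G a b

tier : ∀ {A B : Set} → Dec A → Dec B → D
tier (yes _) _       = d0
tier (no _)  (yes _) = d1
tier (no _)  (no _)  = d2

tier-yes : ∀ {A B : Set} {A? : Dec A} {B? : Dec B} → A → tier A? B? ≡ d0
tier-yes {A? = yes _} _ = refl
tier-yes {A? = no ¬a} a = contradiction a ¬a

module _ {_~_ : Fin n₁ → Fin n₂ → Set} (_~?_ : ∀ P L → Dec (P ~ L)) (c4 : C4Free _~_) where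

  C4Free⇒nonRedundantC6 : ∀ {G} → (∀ {P L} → (P , L) ∈ G → P ~ L) → NonRedundantC6 G
  C4Free⇒nonRedundantC6 {G} G⊆~ {P₀} {L₀} e∈G = record
    { ψ₁ = ψ₁
    ; ψ₂ = ψ₂
    ; zero-at = tier-yes refl , tier-yes refl
    ; C6*-elsewhere = C6*-off ∘ G⊆~
    }
    where
    P₀~L₀ : P₀ ~ L₀
    P₀~L₀ = G⊆~ e∈G

    ψ₁ : Fin n₁ → D
    ψ₁ Q = tier (Q ≟ᶠ P₀) (Q ~? L₀)

    ψ₂ : Fin n₂ → D
    ψ₂ M = tier (M ≟ᶠ L₀) (P₀ ~? M)

    C6*-off : ∀ {Q M} → Q ~ M → (Q , M) ≢ (P₀ , L₀) → C6* (ψ₁ Q) (ψ₂ M)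
    C6*-off {Q} {M} Q~M QM≢P₀L₀ with Q ≟ᶠ P₀ | M ≟ᶠ L₀ | Q ~? L₀ | P₀ ~? M
    ... | yes refl | yes refl | _        | _        = contradiction refl QM≢P₀L₀
    ... | yes refl | no _     | _        | yes _    = c01 , λ { (_ , ()) }
    ... | yes refl | no _     | _        | no P₀≁M  = contradiction Q~M P₀≁M
    ... | no _     | yes refl | yes _    | _        = c10 , λ { (() , _) }
    ... | no _     | yes refl | no Q≁L₀  | _        = contradiction Q~M Q≁L₀
    ... | no Q≢P₀  | no M≢L₀  | yes Q~L₀ | yes P₀~M =
      ⊥-elim (Sum.[ Q≢P₀ ∘ sym , M≢L₀ ∘ sym ] (c4 P₀~L₀ Q~L₀ P₀~M Q~M))
    ... | no _     | no _     | yes _    | no _     = c12 , λ { (() , _) }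
    ... | no _     | no _     | no _     | yes _    = c21 , λ { (() , _) }
    ... | no _     | no _     | no _     | no _     = c22 , λ { (() , _) }

join : Fin n₁ × Fin n₂ → Fin n₃ × Fin n₄ → Edge n₁ n₂ n₃ n₄
join (a , b) (c , d) = a , b , c , d

_⊠_ : List (Fin n₁ × Fin n₂) → List (Fin n₃ × Fin n₄) → List (Edge n₁ n₂ n₃ n₄)
G ⊠ H = cartesianProductWith join G H

∈-⊠⁻ : ∀ (G : List (Fin n₁ × Fin n₂)) (H : List (Fin n₃ × Fin n₄)) {a b c d} →
       (a , b , c , d) ∈ G ⊠ H → (a , b) ∈ G × (c , d) ∈ H
∈-⊠⁻ G H e∈ with ∈-cartesianProductWith⁻ join G H e∈
... | (a , b) , (c , d) , ab∈G , cd∈H , refl = ab∈G , cd∈H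

⊠-unique : ∀ {G : List (Fin n₁ × Fin n₂)} {H : List (Fin n₃ × Fin n₄)} →
           Unique G → Unique H → Unique (G ⊠ H)
⊠-unique = Unique.cartesianProductWith⁺ join
  λ { {a , b} {a′ , b′} {c , d} {c′ , d′} refl → refl , refl }

⊠-nonRedundant : ∀ {G : List (Fin n₁ × Fin n₂)} {H : List (Fin n₃ × Fin n₄)} →
                 NonRedundantC6 G → NonRedundantC6 H → NonRedundant (G ⊠ H)
⊠-nonRedundant {n₁ = n₁} {n₂} {n₃} {n₄} {G} {H} nrG nrH (a , b , c , d) e∈ =
  ψ , R2-elsewhere , (C6-everywhere w ab∈G , C6-everywhere v cd∈H) , ¬R2-at-e
  where
  open C6Witness

  ab∈G : (a , b) ∈ G
  ab∈G = proj₁ (∈-⊠⁻ G H e∈)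

  cd∈H : (c , d) ∈ H
  cd∈H = proj₂ (∈-⊠⁻ G H e∈)

  w : C6Witness G a b
  w = nrG ab∈G

  v : C6Witness H c d
  v = nrH cd∈H

  ψ : Assignment n₁ n₂ n₃ n₄
  ψ = ψ₁ w , ψ₂ w , ψ₁ v , ψ₂ v

  R2-elsewhere : ∀ e′ → e′ ∈ G ⊠ H → e′ ≢ (a , b , c , d) → R2 (apply ψ e′)
  R2-elsewhere (a′ , b′ , c′ , d′) e′∈ e′≢e with ∈-⊠⁻ G H e′∈ | (a′ , b′) ≟ᵖ (a , b)
  ... | ab′∈G , cd′∈H | no ab′≢ab =
    inj₁ (C6*-elsewhere w ab′∈G ab′≢ab , C6-everywhere v cd′∈H)
  ... | ab′∈G , cd′∈H | yes refl  =
    inj₂ (C6-everywhere w ab′∈G , C6*-elsewhere v cd′∈H (e′≢e ∘ cong (join (a , b))))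

  ¬R2-at-e : ¬ R2 (apply ψ (a , b , c , d))
  ¬R2-at-e (inj₁ ((_ , not-00) , _)) = not-00 (zero-at w)
  ¬R2-at-e (inj₂ (_ , (_ , not-00))) = not-00 (zero-at v)

module AffinePlane {p : ℕ} (p-prime : Prime p) where
  open import Data.Integer.Base using (ℤ; +_; _+_; _-_; _*_; ∣_∣; _⊖_; _%ℕ_; _/ℕ_)
  open import Data.Integer.Properties
    using (+-injective; abs-*; ∣i∣≡0⇒i≡0; i-j≡0⇒i≡j; [+m]-[+n]≡m⊖n; ∣m⊝n∣≤m⊔n)
  open import Data.Integer.DivMod using (n%ℕd<d; a≡a%ℕn+[a/ℕn]*n)
  open import Data.Integer.Divisibility.Signed using (_∣_; divides; _∣?_; ∣m∣n⇒∣m-n; ∣⇒∣ᵤ; ∣ᵤ⇒∣)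
  open import Data.Integer.Tactic.RingSolver using (solve-∀)
  import Data.Nat.Divisibility as ℕ

  private instance
    p≢0 : NonZero p
    p≢0 = prime⇒nonZero p-prime

  Point Line : Set
  Point = Fin p × Fin p
  Line  = Fin p × Fin p

  ι : Fin p → ℤ
  ι i = + toℕ i

  -- (k , c) is the line y = k x + c.
  _on_ : Point → Line → Set
  (x , y) on (k , c) = + p ∣ ι k * ι x + ι c - ι y

  _on?_ : ∀ P L → Dec (P on L)
  (x , y) on? (k , c) = + p ∣? ι k * ι x + ι c - ι y

  residue : ℤ → Fin p
  residue a = fromℕ< (n%ℕd<d a p)

  ∣-residue : ∀ a → + p ∣ a - ι (residue a)
  ∣-residue a = divides (a /ℕ p) (begin
    a - ι (residue a)                        ≡⟨ cong (λ r → a - + r) (toℕ-fromℕ< _) ⟩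
    a - + (a %ℕ p)                           ≡⟨ cong (_- + (a %ℕ p)) (a≡a%ℕn+[a/ℕn]*n a p) ⟩
    + (a %ℕ p) + (a /ℕ p) * + p - + (a %ℕ p) ≡⟨ cancel (+ (a %ℕ p)) ((a /ℕ p) * + p) ⟩
    (a /ℕ p) * + p                           ∎)
    where
    open ≡-Reasoning
    cancel : ∀ r s → r + s - r ≡ s
    cancel = solve-∀

  ordinate : Line → Fin p → Fin p
  ordinate (k , c) x = residue (ι k * ι x + ι c)

  on-ordinate : ∀ L x → (x , ordinate L x) on L
  on-ordinate (k , c) x = ∣-residue (ι k * ι x + ι c)

  ∣ι-ι∣<p : ∀ i j → ∣ ι i - ι j ∣ < p
  ∣ι-ι∣<p i j = begin-strict
    ∣ ι i - ι j ∣      ≡⟨ cong ∣_∣ ([+m]-[+n]≡m⊖n (toℕ i) (toℕ j)) ⟩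
    ∣ toℕ i ⊖ toℕ j ∣  ≤⟨ ∣m⊝n∣≤m⊔n (toℕ i) (toℕ j) ⟩
    toℕ i ⊔ toℕ j      <⟨ ⊔-lub (toℕ<n i) (toℕ<n j) ⟩
    p                  ∎
    where open ≤-Reasoning

  ∣<⇒≡0 : ∀ {d} → d < p → p ℕ.∣ d → d ≡ 0
  ∣<⇒≡0 {zero}  _   _   = refl
  ∣<⇒≡0 {suc d} d<p p∣d = contradiction p∣d (ℕ.>⇒∤ d<p)

  ∣ι-ι⇒≡ : ∀ {i j} → + p ∣ ι i - ι j → i ≡ j
  ∣ι-ι⇒≡ {i} {j} p∣i-j = toℕ-injective (+-injective (i-j≡0⇒i≡j (ι i) (ι j)
    (∣i∣≡0⇒i≡0 (∣<⇒≡0 (∣ι-ι∣<p i j) (∣⇒∣ᵤ p∣i-j)))))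

  ∣*⇒∣⊎∣ : ∀ {i j} → + p ∣ i * j → (+ p ∣ i) ⊎ (+ p ∣ j)
  ∣*⇒∣⊎∣ {i} {j} p∣ij =
    Sum.map ∣ᵤ⇒∣ ∣ᵤ⇒∣
      (euclidsLemma ∣ i ∣ ∣ j ∣ p-prime (subst (p ℕ.∣_) (abs-* i j) (∣⇒∣ᵤ p∣ij)))

  private
    slopes : ∀ k k′ c c′ x₁ x₂ y₁ y₂ →
             (k - k′) * (x₁ - x₂) ≡
             ((k * x₁ + c - y₁) - (k′ * x₁ + c′ - y₁))
               - ((k * x₂ + c - y₂) - (k′ * x₂ + c′ - y₂))
    slopes = solve-∀

    intercepts : ∀ k x y c c′ → (k * x + c - y) - (k * x + c′ - y) ≡ c - c′
    intercepts = solve-∀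

    ordinates : ∀ k x c y₁ y₂ → (k * x + c - y₂) - (k * x + c - y₁) ≡ y₁ - y₂
    ordinates = solve-∀

  -- The four incidences give p ∣ (k - k′)(x₁ - x₂): equal slopes force equal intercepts, and
  -- equal abscissae force equal ordinates.
  on-C4Free : C4Free _on_
  on-C4Free {x₁ , y₁} {x₂ , y₂} {k , c} {k′ , c′} PL QL PM QM
    with ∣*⇒∣⊎∣ (subst (+ p ∣_)
                   (sym (slopes (ι k) (ι k′) (ι c) (ι c′) (ι x₁) (ι x₂) (ι y₁) (ι y₂)))
                   (∣m∣n⇒∣m-n (∣m∣n⇒∣m-n PL PM) (∣m∣n⇒∣m-n QL QM)))
  ... | inj₁ p∣k-k′ with refl ← ∣ι-ι⇒≡ {k} {k′} p∣k-k′ =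
    inj₂ (cong (k ,_) (∣ι-ι⇒≡ (subst (+ p ∣_)
                                 (intercepts (ι k) (ι x₁) (ι y₁) (ι c) (ι c′))
                                 (∣m∣n⇒∣m-n PL PM))))
  ... | inj₂ p∣x₁-x₂ with refl ← ∣ι-ι⇒≡ {x₁} {x₂} p∣x₁-x₂ =
    inj₁ (cong (x₁ ,_) (∣ι-ι⇒≡ (subst (+ p ∣_)
                                  (ordinates (ι k) (ι x₁) (ι c) (ι y₁) (ι y₂))
                                  (∣m∣n⇒∣m-n QL PL))))

-- Opened only now: these names clash with the integer operations used in AffinePlane.
open import Data.Nat.Base using (_+_; _*_)
open import Data.Nat.Divisibility using (_∣_; ∣-trans; m∣m*n; m≤n⇒m!∣n!; ∣1⇒≡1; ∣m+n∣m⇒∣n)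
open import Data.Nat.Solver using (module +-*-Solver)

module _ {A : Set} where

  Unique⇒lookup-injective : ∀ {xs : List A} → Unique xs →
                            ∀ {i j} → lookup xs i ≡ lookup xs j → i ≡ j
  Unique⇒lookup-injective (_ ∷ _)    {zero}  {zero}  _  = refl
  Unique⇒lookup-injective (x∉xs ∷ _) {zero}  {suc j} eq =
    contradiction eq (All.lookup x∉xs (∈-lookup j))
  Unique⇒lookup-injective (x∉xs ∷ _) {suc i} {zero}  eq =
    contradiction (sym eq) (All.lookup x∉xs (∈-lookup i))
  Unique⇒lookup-injective (_ ∷ xs!)  {suc i} {suc j} eq =
    cong suc (Unique⇒lookup-injective xs! eq)

  Unique⇒length≤ : ∀ {xs ys : List A} → Unique xs → xs ⊆ ys → length xs ≤ length ys
  Unique⇒length≤ xs! xs⊆ys = injective⇒≤ λ eq →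
    Unique⇒lookup-injective xs!
      (index-injective (setoid A) (xs⊆ys (∈-lookup _)) (xs⊆ys (∈-lookup _)) eq)

length-cartesianProductWith : ∀ {A B C : Set} (f : A → B → C) xs ys →
  length (cartesianProductWith f xs ys) ≡ length xs * length ys
length-cartesianProductWith f List.[] ys = refl
length-cartesianProductWith f (x List.∷ xs) ys = begin
  length (map (f x) ys List.++ cartesianProductWith f xs ys) ≡⟨ length-++ (map (f x) ys) ⟩
  length (map (f x) ys) + length (cartesianProductWith f xs ys)
    ≡⟨ cong₂ _+_ (length-map (f x) ys) (length-cartesianProductWith f xs ys) ⟩
  length ys + length xs * length ys ∎
  where open ≡-Reasoning

length-allFin : ∀ n → length (allFin n) ≡ n
length-allFin n = length-tabulate (λ i → i)

projCard≤length : ∀ I (E : List (Edge n₁ n₂ n₃ n₄)) {Y} → (∀ {e} → e ∈ E → proj I e ∈ Y) →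
                  projCard I E ≤ length Y
projCard≤length I E proj∈Y =
  Unique⇒length≤ (UniqueDec.deduplicate-! _≟P_ (map (proj I) E)) λ z∈ →
    let e , e∈E , z≡proj = ∈-map⁻ (proj I) (∈-deduplicate⁻ _≟P_ (map (proj I) E) z∈)
    in subst (_∈ _) (sym z≡proj) (proj∈Y e∈E)

projCard≤cover : ∀ {A : Set} {k} I (E : List (Edge n₁ n₂ n₃ n₄)) (U : List A)
                 (f : A → Fin k → ProjEdge n₁ n₂ n₃ n₄) →
                 (∀ {e} → e ∈ E → ∃₂ λ u x → u ∈ U × proj I e ≡ f u x) →
                 projCard I E ≤ length U * k
projCard≤cover {k = k} I E U f cover = begin
  projCard I E                               ≤⟨ projCard≤length I E proj∈Y ⟩
  length (cartesianProductWith f U (allFin k)) ≡⟨ length-cartesianProductWith f U (allFin k) ⟩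
  length U * length (allFin k)               ≡⟨ cong (length U *_) (length-allFin k) ⟩
  length U * k                               ∎
  where
  open ≤-Reasoning
  proj∈Y : ∀ {e} → e ∈ E → proj I e ∈ cartesianProductWith f U (allFin k)
  proj∈Y e∈E with u , x , u∈U , proj≡f ← cover e∈E =
    subst (_∈ _) (sym proj≡f) (∈-cartesianProductWith⁺ f u∈U (∈-allFin x))

module _ {n} (G H : List (Fin n × Fin n)) where

  private
    Cover : ∀ I → List (Fin n × Fin n) → (Fin n × Fin n → Fin n → ProjEdge n n n n) → Set
    Cover I U f = ∀ {e} → e ∈ G ⊠ H → ∃₂ λ u x → u ∈ U × proj I e ≡ f u x

    coverG : ∀ I f → Cover I G f → projCard I (G ⊠ H) ≤ (length G ⊔ length H) * n
    coverG I f cover = ≤-trans (projCard≤cover I (G ⊠ H) G f cover)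
                               (*-monoˡ-≤ n (m≤m⊔n (length G) (length H)))

    coverH : ∀ I f → Cover I H f → projCard I (G ⊠ H) ≤ (length G ⊔ length H) * n
    coverH I f cover = ≤-trans (projCard≤cover I (G ⊠ H) H f cover)
                               (*-monoˡ-≤ n (m≤n⊔m (length G) (length H)))

  projCard-⊠ : ∀ I → Proper I → projCard I (G ⊠ H) ≤ (length G ⊔ length H) * n
  projCard-⊠ I@(b₁ , b₂ , b₃ , false) _ =
    coverG I (λ (a , b) x → keep b₁ a , keep b₂ b , keep b₃ x , nothing)
      λ { {a , b , c , d} e∈ → (a , b) , c , proj₁ (∈-⊠⁻ G H e∈) , refl }
  projCard-⊠ I@(b₁ , b₂ , false , true) _ =
    coverG I (λ (a , b) x → keep b₁ a , keep b₂ b , nothing , just x)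
      λ { {a , b , c , d} e∈ → (a , b) , d , proj₁ (∈-⊠⁻ G H e∈) , refl }
  projCard-⊠ I@(b₁ , false , true , true) _ =
    coverH I (λ (c , d) x → keep b₁ x , nothing , just c , just d)
      λ { {a , b , c , d} e∈ → (c , d) , a , proj₂ (∈-⊠⁻ G H e∈) , refl }
  projCard-⊠ I@(false , true , true , true) _ =
    coverH I (λ (c , d) x → nothing , just x , just c , just d)
      λ { {a , b , c , d} e∈ → (c , d) , b , proj₂ (∈-⊠⁻ G H e∈) , refl }
  projCard-⊠ (true , true , true , true) I-proper = contradiction refl I-proper

prime∣n! : ∀ {q n} → Prime q → q ≤ n → q ∣ n !
prime∣n! {zero}  q-prime _   = contradiction q-prime ¬prime[0]
prime∣n! {suc q} _       q≤n = ∣-trans (m∣m*n (q !)) (m≤n⇒m!∣n! q≤n)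

-- Euclid: a prime factor of n! + 1 exceeds n.
prime-above : ∀ n → ∃ λ p → n < p × Prime p
prime-above n with factorise (suc (n !))
... | record { factors = List.[] ; isFactorisation = 1+n!≡1 } =
  contradiction (sym (suc-injective 1+n!≡1)) (<⇒≢ (1≤n! n))
... | record { factors = p List.∷ _ ; isFactorisation = 1+n!≡p*∏
             ; factorsPrime = p-prime All.∷ _ } =
  p , ≰⇒> p≰n , p-prime
  where
  p∣1+n! : p ∣ n ! + 1
  p∣1+n! = subst (p ∣_) (trans (sym 1+n!≡p*∏) (+-comm 1 (n !))) (m∣m*n _)

  p≰n : ¬ p ≤ n
  p≰n p≤n =
    ¬prime[1] (subst Prime (∣1⇒≡1 (∣m+n∣m⇒∣n p∣1+n! (prime∣n! p-prime p≤n))) p-prime)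

remQuot-injective : ∀ {m} k {i j : Fin (m * k)} → remQuot k i ≡ remQuot k j → i ≡ j
remQuot-injective {m} k {i} {j} eq = begin
  i                                 ≡⟨ combine-remQuot {m} k i ⟨
  uncurry combine (remQuot {m} k i) ≡⟨ cong (uncurry (combine {m})) eq ⟩
  uncurry combine (remQuot {m} k j) ≡⟨ combine-remQuot {m} k j ⟩
  j                                 ∎
  where open ≡-Reasoning

module PlaneGraph {p : ℕ} (p-prime : Prime p) where
  open AffinePlane p-prime

  n : ℕ
  n = p * p

  coordinates : Fin n → Fin p × Fin p
  coordinates = remQuot p

  _∼_ : Fin n → Fin n → Set
  P ∼ L = coordinates P on coordinates L

  incidence : Fin n → Fin p → Fin n × Fin n
  incidence L x = combine x (ordinate (coordinates L) x) , L

  incidences : List (Fin n × Fin n)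
  incidences = cartesianProductWith incidence (allFin n) (allFin p)

  incidences⊆∼ : ∀ {P L} → (P , L) ∈ incidences → P ∼ L
  incidences⊆∼ PL∈
    with L , x , _ , _ , refl ← ∈-cartesianProductWith⁻ incidence (allFin n) (allFin p) PL∈ =
    subst (_on coordinates L) (sym (remQuot-combine x _)) (on-ordinate (coordinates L) x)

  incidence-injective : ∀ {L L′ x x′} → incidence L x ≡ incidence L′ x′ → L ≡ L′ × x ≡ x′
  incidence-injective {x = x} {x′} eq =
    proj₂ (,-injective eq) , combine-injectiveˡ x _ x′ _ (proj₁ (,-injective eq))

  incidences-unique : Unique incidences
  incidences-unique =
    Unique.cartesianProductWith⁺ incidence incidence-injective (Unique.allFin⁺ n) (Unique.allFin⁺ p)

  length-incidences : length incidences ≡ n * p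
  length-incidences = trans (length-cartesianProductWith incidence (allFin n) (allFin p))
                            (cong₂ _*_ (length-allFin n) (length-allFin p))

  incidences-nonRedundantC6 : NonRedundantC6 incidences
  incidences-nonRedundantC6 =
    C4Free⇒nonRedundantC6 (λ P L → coordinates P on? coordinates L)
      (C4Free-preimage {f = coordinates} {g = coordinates}
        (remQuot-injective {p} p) (remQuot-injective {p} p) on-C4Free)
      incidences⊆∼

  E : List (Edge n n n n)
  E = incidences ⊠ incidences

  private instance
    p≢0 : NonZero p
    p≢0 = prime⇒nonZero p-prime

  E-unique : Unique E
  E-unique = ⊠-unique incidences-unique incidences-unique

  E-nonRedundant : NonRedundant E
  E-nonRedundant = ⊠-nonRedundant incidences-nonRedundantC6 incidences-nonRedundantC6

  |E|≡p⁶ : length E ≡ p ^ 6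
  |E|≡p⁶ = begin
    length E                              ≡⟨ length-cartesianProductWith join incidences incidences ⟩
    length incidences * length incidences ≡⟨ cong₂ _*_ length-incidences length-incidences ⟩
    n * p * (n * p)                       ≡⟨ x³x³≡x⁶ p ⟩
    p ^ 6                                 ∎
    where
    open ≡-Reasoning
    x³x³≡x⁶ : ∀ x → x * x * x * (x * x * x) ≡ x ^ 6
    x³x³≡x⁶ = solve 1 (λ x → x :* x :* x :* (x :* x :* x) := x :^ 6) refl
      where open +-*-Solver

  projCard≤p⁵ : ∀ I → Proper I → projCard I E ≤ p ^ 5
  projCard≤p⁵ I I-proper = begin
    projCard I E                                ≤⟨ projCard-⊠ incidences incidences I I-proper ⟩
    (length incidences ⊔ length incidences) * n ≡⟨ cong (_* n) (⊔-idem (length incidences)) ⟩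
    length incidences * n                       ≡⟨ cong (_* n) length-incidences ⟩
    n * p * n                                   ≡⟨ x³x²≡x⁵ p ⟩
    p ^ 5                                       ∎
    where
    open ≤-Reasoning
    x³x²≡x⁵ : ∀ x → x * x * x * (x * x) ≡ x ^ 5
    x³x²≡x⁵ = solve 1 (λ x → x :* x :* x :* (x :* x) := x :^ 5) refl
      where open +-*-Solver

  p≤|E| : p ≤ length E
  p≤|E| = begin
    p        ≡⟨ ^-identityʳ p ⟨
    p ^ 1    ≤⟨ ^-monoʳ-≤ p {1} {6} (s≤s z≤n) ⟩
    p ^ 6    ≡⟨ |E|≡p⁶ ⟨
    length E ∎
    where open ≤-Reasoning

  E-shrinking : ∀ I → Proper I → projCard I E ^ 6 ≤ length E ^ 5
  E-shrinking I I-proper = begin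
    projCard I E ^ 6 ≤⟨ ^-monoˡ-≤ 6 (projCard≤p⁵ I I-proper) ⟩
    (p ^ 5) ^ 6      ≡⟨ ^-*-assoc p 5 6 ⟩
    p ^ 30           ≡⟨ ^-*-assoc p 6 5 ⟨
    (p ^ 6) ^ 5      ≡⟨ cong (_^ 5) |E|≡p⁶ ⟨
    length E ^ 5     ∎
    where open ≤-Reasoning

lemma4p5 : Σ ℕ λ C → 0 < C ×
    ((N : ℕ) → Σ ℕ λ m → N ≤ m ×
      Σ ℕ λ n₁ → Σ ℕ λ n₂ → Σ ℕ λ n₃ → Σ ℕ λ n₄ →
      Σ _ λ (E : List (Edge n₁ n₂ n₃ n₄)) →
        Unique E × length E ≡ m × NonRedundant E ×
        ((I : Subset4) → Proper I → projCard I E ^ 6 ≤ C ^ 6 * m ^ 5))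
lemma4p5 = 1 , z<s , λ N →
  let p , N<p , p-prime = prime-above N
      open PlaneGraph p-prime
  in length E , ≤-trans (<⇒≤ N<p) p≤|E| , n , n , n , n , E , E-unique , refl , E-nonRedundant ,
     λ I I-proper →
       subst (projCard I E ^ 6 ≤_) (sym (*-identityˡ (length E ^ 5))) (E-shrinking I I-proper)
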